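{- Every finite semidistrim lattice is crosscut simplicial.
   Context: All lattices are finite. For a lattice $L$, $\mathcal{J}_L$ (resp. $\mathcal{M}_L$) is the set of join-irreducible (resp. meet-irreducible) elements; for $j\in\mathcal{J}_L$, $j_*$ is the unique element covered by $j$, and for $m\in\mathcal{M}_L$, $m^*$ is the unique element covering $m$. Let $\mathcal{M}_L(j)=\max\{z\in L: j_*=j\wedge z\}$ and $\mathcal{J}_L(m)=\min\{z\in L: m^*=m\vee z\}$. A pairing on $L$ is a bijection $\kappa:\mathcal{J}_L\to\mathcal{M}_L$ with $\kappa(j)\in\mathcal{M}_L(j)$ for all $j$ and $\kappa^{ -1}(m)\in\mathcal{J}_L(m)$ for all $m$; $L$ is uniquely paired if it has exactly one pairing, denoted $\kappa_L$. A prime pair is a pair $(j_0,m_0)$ with $L=[\hat0,m_0]\sqcup[j_0,\hat1]$. A uniquely paired lattice $L$ is compatibly dismantlable if $|L|=1$ or there is a prime pair $(j_0,m_0)$ such that: (i) $[j_0,\hat1]$ is compatibly dismantlable and $\alpha(j)=j_0\vee j$ defines a bijection $\{j\in\mathcal{J}_L: j_0\le\kappa_L(j)\}\to\mathcal{J}_{[j_0,\hat1]}$ with $\kappa_{[j_0,\hat1]}(\alpha(j))=\kappa_L(j)$; (ii) $[\hat0,m_0]$ is compatibly dismantlable and $\beta(m)=m_0\wedge m$ defines a bijection $\{m\in\mathcal{M}_L:\kappa_L^{ -1}(m)\le m_0\}\to\mathcal{M}_{[\hat0,m_0]}$ with $\kappa_{[\hat0,m_0]}^{ -1}(\beta(m))=\kappa_L^{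 -1}(m)$. The Galois graph $G_L$ is the directed graph on $\mathcal{J}_L$ with an edge $j\to j'$ iff $j\ne j'$ and $j\not\le\kappa_L(j')$. For $x\in L$ let $J_L(x)=\{j\in\mathcal{J}_L:j\le x\}$ and $M_L(x)=\{j\in\mathcal{J}_L:\kappa_L(j)\ge x\}$. For a compatibly dismantlable $L$, for every cover $x\lessdot y$ the set $M_L(x)\cap J_L(y)$ has exactly one element $j_{xy}$; set $\mathcal{D}_L(x)=\{j_{yx}:y\lessdot x\}$ and $\mathcal{U}_L(x)=\{j_{xy}:x\lessdot y\}$. $L$ is semidistrim if it is compatibly dismantlable and $\mathcal{D}_L(x)$, $\mathcal{U}_L(x)$ are independent sets (no two elements adjacent) of $G_L$ for all $x\in L$. The crosscut complex of a lattice $L$ is the simplicial complex whose faces are the sets $A$ of atoms of $L$ with $\bigvee A\ne\hat1$. $L$ is crosscut simplicial if for all $u\le v$ in $L$, every proper subset of the set of atoms of the interval $[u,v]$ is a face of the crosscut complex of $[u,v]$. -}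

module Defs where

open import Level using (0ℓ)
open import Data.Nat using (ℕ)
open import Data.Fin using (Fin)
open import Data.Bool using (if_then_else_)
open import Data.Vec using (lookup)
open import Data.List using (foldr; allFin)
open import Data.Fin.Subset using (Subset; _∈_; _∉_)
open import Data.Product using (Σ; _×_; ∃)
open import Data.Sum using (_⊎_)
open import Data.Empty using (⊥)
open import Relation.Nullary using (¬_)
open import Relation.Binary.Core using (Rel)
open import Relation.Binary.PropositionalEquality using (_≡_; _≢_)
open import Relation.Binary.Lattice.Structures using (IsBoundedLattice)
open import Algebra.Core using (Op₂)

-- A finite lattice: carrier Fin n (every finite lattice is isomorphic to one
-- of this form), partial order _≤_ (w.r.t. propositional equality), join _∨_,
-- meet _∧_, top 𝟙 and bottom 𝟘 (a finite nonempty lattice is bounded).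
record FiniteLattice : Set₁ where
  field
    n : ℕ
    _≤_ : Rel (Fin n) 0ℓ
    _∨_ _∧_ : Op₂ (Fin n)
    𝟙 𝟘 : Fin n
    isBoundedLattice : IsBoundedLattice _≡_ _≤_ _∨_ _∧_ 𝟙 𝟘

module Notions (L : FiniteLattice) where
  open FiniteLattice L

  El : Set
  El = Fin n

  -- cover relation x ⋖ y (intrinsic; intervals are convex)
  _⋖_ : El → El → Set
  x ⋖ y = x ≤ y × x ≢ y × (∀ z → x ≤ z → z ≤ y → z ≡ x ⊎ z ≡ y)

  -- All lattice notions below are taken in the interval [u , v] of L,
  -- regarded as a lattice in its own right (bottom u, top v, with the
  -- meet and join of L).  The whole lattice is the interval [𝟘 , 𝟙].
  module Interval (u v : El) where

    In : El → Set
    In x = u ≤ x × x ≤ v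

    JI : El → Set
    JI j = In j × j ≢ u ×
           (∀ x y → In x → In y → x ∨ y ≡ j → x ≡ j ⊎ y ≡ j)

    MI : El → Set
    MI m = In m × m ≢ v ×
           (∀ x y → In x → In y → x ∧ y ≡ m → x ≡ m ⊎ y ≡ m)

    -- z satisfies  j_* = j ∧ z  (j_* the element of [u,v] covered by j)
    LowerCond : El → El → Set
    LowerCond j z = ∀ y → In y → y ⋖ j → j ∧ z ≡ y

    InMof : El → El → Set
    InMof j z = In z × LowerCond j z ×
                (∀ z' → In z' → z ≤ z' → LowerCond j z' → z' ≡ z)

    -- z satisfies  m^* = m ∨ z  (m^* the element of [u,v] covering m)
    UpperCond : El → El → Set
    UpperCond m z = ∀ y → In y → m ⋖ y → m ∨ z ≡ y

    InJof : El → El → Set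
    InJof m z = In z × UpperCond m z ×
                (∀ z' → In z' → z' ≤ z → UpperCond m z' → z' ≡ z)

    Pairing : (El → El) → Set
    Pairing κ =
      (∀ j → JI j → MI (κ j)) ×
      (∀ j j' → JI j → JI j' → κ j ≡ κ j' → j ≡ j') ×
      (∀ m → MI m → ∃ λ j → JI j × κ j ≡ m) ×
      (∀ j → JI j → InMof j (κ j)) ×
      (∀ j → JI j → InJof (κ j) j)

    UniquelyPairedBy : (El → El) → Set
    UniquelyPairedBy κ =
      Pairing κ × (∀ κ' → Pairing κ' → ∀ j → JI j → κ' j ≡ κ j)

    PrimePair : El → El → Set
    PrimePair j₀ m₀ =
      In j₀ × In m₀ ×
      (∀ x → In x → x ≤ m₀ ⊎ j₀ ≤ x) ×
      (∀ x → In x → x ≤ m₀ → j₀ ≤ x → ⊥)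

  open Interval

  -- Compatibly dismantlable intervals, indexed by their unique pairing.
  -- CD u v κ : [u,v] is compatibly dismantlable and κ = κ_[u,v].
  data CD (u v : El) (κ : El → El) : Set where
    cd-single : UniquelyPairedBy u v κ → u ≡ v → CD u v κ
    cd-step :
      UniquelyPairedBy u v κ →
      (j₀ m₀ : El) → PrimePair u v j₀ m₀ →
      (κ₁ : El → El) → CD j₀ v κ₁ →
      (∀ j → JI u v j → j₀ ≤ κ j →
         JI j₀ v (j₀ ∨ j) × κ₁ (j₀ ∨ j) ≡ κ j) →
      (∀ j j' → JI u v j → j₀ ≤ κ j → JI u v j' → j₀ ≤ κ j' →
         j₀ ∨ j ≡ j₀ ∨ j' → j ≡ j') →
      (∀ j' → JI j₀ v j' → ∃ λ j → JI u v j × j₀ ≤ κ j × j₀ ∨ j ≡ j') →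
      -- condition (ii)   (κ⁻¹(m) is the j ∈ JI u v with κ j ≡ m)
      (κ₂ : El → El) → CD u m₀ κ₂ →
      (∀ m j → MI u v m → JI u v j → κ j ≡ m → j ≤ m₀ →
         MI u m₀ (m₀ ∧ m) × JI u m₀ j × κ₂ j ≡ m₀ ∧ m) →
      (∀ m m' → MI u v m → (∃ λ j → JI u v j × κ j ≡ m × j ≤ m₀) →
                MI u v m' → (∃ λ j → JI u v j × κ j ≡ m' × j ≤ m₀) →
         m₀ ∧ m ≡ m₀ ∧ m' → m ≡ m') →
      (∀ m' → MI u m₀ m' → ∃ λ m → MI u v m ×
         (∃ λ j → JI u v j × κ j ≡ m × j ≤ m₀) × m₀ ∧ m ≡ m') →
      CD u v κ

  module WithPairing (κ : El → El) where

    J : El → Set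
    J = JI 𝟘 𝟙

    Edge : El → El → Set
    Edge j j' = J j × J j' × j ≢ j' × ¬ (j ≤ κ j')

    InMJ : El → El → El → Set
    InMJ x y j = J j × x ≤ κ j × j ≤ y

    Down : El → El → Set
    Down x j = ∃ λ y → y ⋖ x × InMJ y x j

    Up : El → El → Set
    Up x j = ∃ λ y → x ⋖ y × InMJ x y j

    Independent : (El → Set) → Set
    Independent S = ∀ j j' → S j → S j' → ¬ Edge j j'

  -- join of a set A of elements, computed in [u, _] (empty join = u)
  joinFrom : El → Subset n → El
  joinFrom u A = foldr (λ x acc → if lookup A x then x ∨ acc else acc) u (allFin n)

  Atom : El → El → El → Set
  Atom u v a = a ≤ v × u ⋖ a

module _ (L : FiniteLattice) where
  open FiniteLattice L
  open Notions L

  Semidistrim : Set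
  Semidistrim = Σ (El → El) λ κ → CD 𝟘 𝟙 κ ×
    (∀ x → WithPairing.Independent κ (WithPairing.Down κ x) ×
           WithPairing.Independent κ (WithPairing.Up κ x))

  -- for all u ≤ v, every proper subset A of the atoms of [u,v] is a face of
  -- the crosscut complex of [u,v], i.e. ⋁A ≠ v
  CrosscutSimplicial : Set
  CrosscutSimplicial = ∀ u v → u ≤ v → (A : Subset n) →
    (∀ a → a ∈ A → Atom u v a) →
    (∃ λ a → Atom u v a × a ∉ A) →
    joinFrom u A ≢ v

-- The label j_{uy} of a cover u ⋖ y, obtained by induction along the compatible
-- dismantling, satisfies u ∨ j_{uy} = y and u ≤ κ(j_{uy}).  For atoms a ≠ b of
-- [u,v], independence of 𝒰(u) forbids the edge j_b → j_a of the Galois graph,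
-- so j_b ≤ κ(j_a) and hence b = u ∨ j_b ≤ κ(j_a).  Thus every set of atoms
-- missing a has its join below κ(j_a), whereas j_a ≤ a ≤ v and j_a ≰ κ(j_a):
-- that join cannot be v.
module Submission where

open import Level using (0ℓ)
open import Data.Bool using (true; false; if_then_else_)
open import Data.Empty using (⊥-elim)
open import Data.Fin using (Fin; _≟_)
open import Data.Fin.Induction using (po-wellFounded)
open import Data.Fin.Properties using (any?)
open import Data.Fin.Subset using (Subset; _∈_)
open import Data.List using ([]; _∷_; foldr; allFin)
open import Data.Product using (∃; _×_; _,_; proj₁; proj₂)
open import Data.Sum using (_⊎_; inj₁; inj₂)
open import Data.Vec using (lookup)
open import Data.Vec.Properties using (lookup⇒[]=)
open import Function using (_∘_; flip)
open import Induction.WellFounded using (Acc; acc)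
open import Relation.Binary.Core using (Rel)
open import Relation.Binary.Definitions using (Decidable)
open import Relation.Binary.Structures using (IsPartialOrder)
open import Relation.Binary.Lattice.Structures using (IsBoundedLattice)
import Relation.Binary.Construct.Flip.EqAndOrd as Flip
import Relation.Binary.Construct.NonStrictToStrict as ToStrict
open import Relation.Binary.PropositionalEquality using (_≡_; _≢_; refl; sym; trans; subst)
open import Relation.Nullary using (¬_; Dec; yes; no; ¬?)
open import Relation.Nullary.Decidable using (_×-dec_; decidable-stable)

open import Defs

module _ {n} {_⊑_ : Rel (Fin n) 0ℓ} (isPO : IsPartialOrder _≡_ _⊑_) (_⊑?_ : Decidable _⊑_) where
  open IsPartialOrder isPO using (reflexive) renaming (trans to ⊑-trans)
  open ToStrict _≡_ _⊑_ using (_<_)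

  minimal-below : {P : Fin n → Set} → (∀ x → Dec (P x)) → ∀ {x} → P x →
                  ∃ λ m → P m × m ⊑ x × (∀ y → P y → y ⊑ m → y ≡ m)
  minimal-below {P} P? {x} Px = go (po-wellFounded isPO x) Px
    where
    go : ∀ {x} → Acc _<_ x → P x → ∃ λ m → P m × m ⊑ x × (∀ y → P y → y ⊑ m → y ≡ m)
    go {x} (acc descend) Px with any? (λ y → P? y ×-dec (y ⊑? x ×-dec ¬? (y ≟ x)))
    ... | yes (y , Py , y<x) =
      let m , Pm , m⊑y , minimal = go (descend y<x) Py
      in m , Pm , ⊑-trans m⊑y (proj₁ y<x) , minimal
    ... | no nothing-below = x , Px , reflexive refl ,
      λ y Py y⊑x → decidable-stable (y ≟ x) (λ y≢x → nothing-below (y , Py , y⊑x , y≢x))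

module Properties (L : FiniteLattice) where
  open FiniteLattice L
  open Notions L
  open Interval
  open IsBoundedLattice isBoundedLattice
    renaming (refl to ≤-refl; trans to ≤-trans; antisym to ≤-antisym)

  _≤?_ : Decidable _≤_
  x ≤? y with x ∨ y ≟ y
  ... | yes x∨y≡y = yes (subst (x ≤_) x∨y≡y (x≤x∨y x y))
  ... | no x∨y≢y = no λ x≤y → x∨y≢y (≤-antisym (∨-least x≤y ≤-refl) (y≤x∨y x y))

  cover-above : ∀ {a b} → a ≤ b → a ≢ b → ∃ λ c → a ⋖ c × c ≤ b
  cover-above {a} a≤b a≢b
    with minimal-below isPartialOrder _≤?_ (λ c → a ≤? c ×-dec ¬? (a ≟ c)) (a≤b , a≢b)
  ... | c , (a≤c , a≢c) , c≤b , minimal = c , (a≤c , a≢c , between) , c≤b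
    where
    between : ∀ z → a ≤ z → z ≤ c → z ≡ a ⊎ z ≡ c
    between z a≤z z≤c with z ≟ a
    ... | yes z≡a = inj₁ z≡a
    ... | no z≢a = inj₂ (minimal z (a≤z , z≢a ∘ sym) z≤c)

  cover-below : ∀ {a b} → a ≤ b → a ≢ b → ∃ λ c → c ⋖ b × a ≤ c
  cover-below {b = b} a≤b a≢b
    with minimal-below (Flip.isPartialOrder isPartialOrder) (flip _≤?_)
                       (λ c → c ≤? b ×-dec ¬? (c ≟ b)) (a≤b , a≢b)
  ... | c , (c≤b , c≢b) , a≤c , maximal = c , (c≤b , c≢b , between) , a≤c
    where
    between : ∀ z → c ≤ z → z ≤ b → z ≡ c ⊎ z ≡ b
    between z c≤z z≤b with z ≟ b
    ... | yes z≡b = inj₂ z≡b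
    ... | no z≢b = inj₁ (maximal z (z≤b , z≢b) c≤z)

  joinFrom-least : ∀ {u k} (A : Subset n) → u ≤ k → (∀ x → x ∈ A → x ≤ k) → joinFrom u A ≤ k
  joinFrom-least {u} {k} A u≤k A≤k = go (allFin n)
    where
    go : ∀ xs → foldr (λ x acc → if lookup A x then x ∨ acc else acc) u xs ≤ k
    go [] = u≤k
    go (x ∷ xs) with lookup A x in x∈A
    ... | true = ∨-least (A≤k x (lookup⇒[]= x A x∈A)) (go xs)
    ... | false = go xs

  module _ {u v : El} where

    pairing⇒j≰κj : ∀ {κ j} → Pairing u v κ → JI u v j → ¬ j ≤ κ j
    pairing⇒j≰κj {κ} {j} (_ , _ , _ , κ∈𝓜 , _) jJI@((u≤j , j≤v) , j≢u , _) j≤κj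
      with cover-below u≤j (j≢u ∘ sym)
    ... | c , c⋖j@(c≤j , c≢j , _) , u≤c =
      c≢j (trans (sym (lowerCond c (u≤c , ≤-trans c≤j j≤v) c⋖j))
                 (≤-antisym (x∧y≤x j (κ j)) (∧-greatest ≤-refl j≤κj)))
      where lowerCond = proj₁ (proj₂ (κ∈𝓜 j jJI))

    module _ {j₀ m₀ : El} where

      primePair⇒m₀≢v : PrimePair u v j₀ m₀ → m₀ ≢ v
      primePair⇒m₀≢v (j₀∈ , _ , _ , disjoint) m₀≡v =
        disjoint j₀ j₀∈ (subst (j₀ ≤_) (sym m₀≡v) (proj₂ j₀∈)) ≤-refl

      primePair⇒MI : PrimePair u v j₀ m₀ → MI u v m₀
      primePair⇒MI pp@(j₀∈ , m₀∈ , split , disjoint) = m₀∈ , primePair⇒m₀≢v pp , irreducible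
        where
        irreducible : ∀ a b → In u v a → In u v b → a ∧ b ≡ m₀ → a ≡ m₀ ⊎ b ≡ m₀
        irreducible a b a∈ b∈ a∧b≡m₀ with split a a∈ | split b b∈
        ... | inj₁ a≤m₀ | _ = inj₁ (≤-antisym a≤m₀ (subst (_≤ a) a∧b≡m₀ (x∧y≤x a b)))
        ... | inj₂ _ | inj₁ b≤m₀ = inj₂ (≤-antisym b≤m₀ (subst (_≤ b) a∧b≡m₀ (x∧y≤y a b)))
        ... | inj₂ j₀≤a | inj₂ j₀≤b =
          ⊥-elim (disjoint j₀ j₀∈ (subst (j₀ ≤_) a∧b≡m₀ (∧-greatest j₀≤a j₀≤b)) ≤-refl)

      primePair⇒upperCond : PrimePair u v j₀ m₀ → UpperCond u v m₀ j₀
      primePair⇒upperCond (j₀∈ , _ , split , disjoint) c c∈ (m₀≤c , m₀≢c , between)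
        with split c c∈
      ... | inj₁ c≤m₀ = ⊥-elim (m₀≢c (≤-antisym m₀≤c c≤m₀))
      ... | inj₂ j₀≤c with between (m₀ ∨ j₀) (x≤x∨y m₀ j₀) (∨-least m₀≤c j₀≤c)
      ...   | inj₂ m₀∨j₀≡c = m₀∨j₀≡c
      ...   | inj₁ m₀∨j₀≡m₀ =
        ⊥-elim (disjoint j₀ j₀∈ (subst (j₀ ≤_) m₀∨j₀≡m₀ (y≤x∨y m₀ j₀)) ≤-refl)

      primePair⇒j₀≤ : PrimePair u v j₀ m₀ → ∀ {j} → In u v j → UpperCond u v m₀ j → j₀ ≤ j
      primePair⇒j₀≤ pp@(_ , (u≤m₀ , m₀≤v) , split , _) {j} j∈ upper with split j j∈
      ... | inj₂ j₀≤j = j₀≤j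
      ... | inj₁ j≤m₀ with cover-above m₀≤v (primePair⇒m₀≢v pp)
      ...   | c , m₀⋖c@(m₀≤c , m₀≢c , _) , c≤v =
        ⊥-elim (m₀≢c (trans (sym m₀∨j≡m₀) (upper c (≤-trans u≤m₀ m₀≤c , c≤v) m₀⋖c)))
        where
        m₀∨j≡m₀ : m₀ ∨ j ≡ m₀
        m₀∨j≡m₀ = ≤-antisym (∨-least ≤-refl j≤m₀) (x≤x∨y m₀ j)

      pairing⇒κj₀≡m₀ : ∀ {κ} → Pairing u v κ → PrimePair u v j₀ m₀ → JI u v j₀ × κ j₀ ≡ m₀
      pairing⇒κj₀≡m₀ {κ} (_ , _ , onto , _ , κ⁻¹∈𝓙) pp with onto m₀ (primePair⇒MI pp)
      ... | j , jJI , κj≡m₀ with κ⁻¹∈𝓙 j jJI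
      ...   | j∈ , upper , minimal = subst (λ i → JI u v i × κ i ≡ m₀) (sym j₀≡j) (jJI , κj≡m₀)
        where
        j₀≡j : j₀ ≡ j
        j₀≡j = minimal j₀ (proj₁ pp)
          (primePair⇒j₀≤ pp j∈ (subst (λ m → UpperCond u v m j) κj≡m₀ upper))
          (subst (λ m → UpperCond u v m j₀) (sym κj≡m₀) (primePair⇒upperCond pp))

  CD⇒pairing : ∀ {u v κ} → CD u v κ → Pairing u v κ
  CD⇒pairing (cd-single (pairing , _) _) = pairing
  CD⇒pairing (cd-step (pairing , _) _ _ _ _ _ _ _ _ _ _ _ _ _) = pairing

  Labels : El → El → (El → El) → El → El → El → Set
  Labels u v κ x y j = JI u v j × x ≤ κ j × j ≤ y

  labels-from-upper : ∀ {u v κ j₀ κ₁ x y} →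
    (∀ j → JI u v j → j₀ ≤ κ j → JI j₀ v (j₀ ∨ j) × κ₁ (j₀ ∨ j) ≡ κ j) →
    (∀ j' → JI j₀ v j' → ∃ λ j → JI u v j × j₀ ≤ κ j × j₀ ∨ j ≡ j') →
    ∃ (Labels j₀ v κ₁ x y) → ∃ (Labels u v κ x y)
  labels-from-upper {j₀ = j₀} {x = x} α-κ α-onto (j' , j'JI , x≤κ₁j' , j'≤y)
    with α-onto j' j'JI
  ... | j , jJI , j₀≤κj , refl =
    j , jJI , subst (x ≤_) (proj₂ (α-κ j jJI j₀≤κj)) x≤κ₁j' , ≤-trans (y≤x∨y j₀ j) j'≤y

  labels-from-lower : ∀ {u v κ m₀ κ₂ x y} → Pairing u m₀ κ₂ →
    (∀ m j → MI u v m → JI u v j → κ j ≡ m → j ≤ m₀ →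
       MI u m₀ (m₀ ∧ m) × JI u m₀ j × κ₂ j ≡ m₀ ∧ m) →
    (∀ m' → MI u m₀ m' → ∃ λ m → MI u v m ×
       (∃ λ j → JI u v j × κ j ≡ m × j ≤ m₀) × m₀ ∧ m ≡ m') →
    ∃ (Labels u m₀ κ₂ x y) → ∃ (Labels u v κ x y)
  labels-from-lower {κ = κ} {m₀} {κ₂} {x} {y} (κ₂-MI , κ₂-injective , _) β-κ β-onto
                    (j , jJI , x≤κ₂j , j≤y)
    with β-onto (κ₂ j) (κ₂-MI j jJI)
  ... | m , mMI , (j' , j'JI , refl , j'≤m₀) , m₀∧κj'≡κ₂j
    with β-κ m j' mMI j'JI refl j'≤m₀
  ... | _ , j'JI₂ , κ₂j'≡m₀∧κj' =
    j' , j'JI , ≤-trans x≤κ₂j (subst (_≤ κ j') m₀∧κj'≡κ₂j (x∧y≤y m₀ (κ j'))) ,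
    subst (_≤ y) (sym j'≡j) j≤y
    where
    j'≡j : j' ≡ j
    j'≡j = κ₂-injective j' j j'JI₂ jJI (trans κ₂j'≡m₀∧κj' m₀∧κj'≡κ₂j)

  cover-labels : ∀ {u v κ} → CD u v κ → ∀ {x y} → In u v x → In u v y → x ⋖ y →
                 ∃ (Labels u v κ x y)
  cover-labels (cd-single _ refl) (u≤x , x≤u) (u≤y , y≤u) (_ , x≢y , _) =
    ⊥-elim (x≢y (trans (≤-antisym x≤u u≤x) (sym (≤-antisym y≤u u≤y))))
  cover-labels (cd-step (pairing , _) j₀ m₀ pp@(_ , _ , split , disjoint)
                        _ cd₁ α-κ _ α-onto _ cd₂ β-κ _ β-onto)
               {x} {y} x∈@(u≤x , x≤v) y∈@(u≤y , y≤v) x⋖y@(x≤y , _)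
    with split x x∈ | split y y∈
  ... | inj₂ j₀≤x | inj₂ j₀≤y =
    labels-from-upper α-κ α-onto (cover-labels cd₁ (j₀≤x , x≤v) (j₀≤y , y≤v) x⋖y)
  ... | inj₁ x≤m₀ | inj₁ y≤m₀ =
    labels-from-lower (CD⇒pairing cd₂) β-κ β-onto (cover-labels cd₂ (u≤x , x≤m₀) (u≤y , y≤m₀) x⋖y)
  ... | inj₁ x≤m₀ | inj₂ j₀≤y =
    let j₀JI , κj₀≡m₀ = pairing⇒κj₀≡m₀ pairing pp
    in j₀ , j₀JI , subst (x ≤_) (sym κj₀≡m₀) x≤m₀ , j₀≤y
  ... | inj₂ j₀≤x | inj₁ y≤m₀ = ⊥-elim (disjoint x x∈ (≤-trans x≤y y≤m₀) j₀≤x)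

  module _ {κ : El → El} (cd : CD 𝟘 𝟙 κ) where
    open WithPairing κ

    up-label : ∀ {u b} → u ⋖ b → ∃ (InMJ u b)
    up-label = cover-labels cd (minimum _ , maximum _) (minimum _ , maximum _)

    label-join : ∀ {u b j} → u ⋖ b → InMJ u b j → u ∨ j ≡ b
    label-join {u} {j = j} (u≤b , _ , between) (jJI , u≤κj , j≤b)
      with between (u ∨ j) (x≤x∨y u j) (∨-least u≤b j≤b)
    ... | inj₂ u∨j≡b = u∨j≡b
    ... | inj₁ u∨j≡u = ⊥-elim (pairing⇒j≰κj (CD⇒pairing cd) jJI
                                 (≤-trans (subst (j ≤_) u∨j≡u (y≤x∨y u j)) u≤κj))

    independent-up⇒≤κ : ∀ {u a b ja jb} → Independent (Up u) →
      u ⋖ a → InMJ u a ja → u ⋖ b → InMJ u b jb → a ≢ b → b ≤ κ ja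
    independent-up⇒≤κ {a = a} {b} {ja} {jb} independent u⋖a ja∈@(jaJI , u≤κja , _)
                      u⋖b jb∈@(jbJI , _) a≢b with jb ≟ ja
    ... | yes refl = ⊥-elim (a≢b (trans (sym (label-join u⋖a ja∈)) (label-join u⋖b jb∈)))
    ... | no jb≢ja = subst (_≤ κ ja) (label-join u⋖b jb∈) (∨-least u≤κja jb≤κja)
      where
      jb≤κja : jb ≤ κ ja
      jb≤κja = decidable-stable (jb ≤? κ ja) λ jb≰κja →
        independent jb ja (b , u⋖b , jb∈) (a , u⋖a , ja∈) (jbJI , jaJI , jb≢ja , jb≰κja)

    joinFrom-atoms≤κ : ∀ {u v a ja} → Independent (Up u) → u ⋖ a → InMJ u a ja →
      (A : Subset n) → (∀ b → b ∈ A → Atom u v b) → ¬ a ∈ A → joinFrom u A ≤ κ ja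
    joinFrom-atoms≤κ independent u⋖a ja∈@(_ , u≤κja , _) A A-atoms a∉A =
      joinFrom-least A u≤κja λ b b∈A →
        let u⋖b = proj₂ (A-atoms b b∈A)
        in independent-up⇒≤κ independent u⋖a ja∈ u⋖b (proj₂ (up-label u⋖b))
             (λ a≡b → a∉A (subst (_∈ A) (sym a≡b) b∈A))

theorem8p1 : (L : FiniteLattice) → Semidistrim L → CrosscutSimplicial L
theorem8p1 L (κ , cd , independent) u v _ A A-atoms (a , (a≤v , u⋖a) , a∉A) ⋁A≡v =
  let ja , ja∈ = up-label cd u⋖a
      jaJI , _ , ja≤a = ja∈
      ⋁A≤κja = joinFrom-atoms≤κ cd (proj₂ (independent u)) u⋖a ja∈ A A-atoms a∉A
  in pairing⇒j≰κj (CD⇒pairing cd) jaJI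
       (≤-trans ja≤a (≤-trans a≤v (subst (_≤ κ ja) ⋁A≡v ⋁A≤κja)))
  where
  open FiniteLattice L
  open Properties L
  open IsBoundedLattice isBoundedLattice using () renaming (trans to ≤-trans)
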